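{- Let $\mathbf{L}$ be a dually ms Stone semi-Heyting algebra and $x\in L$. Then $(x^*)^+ = x^{**}$, where $y^+ := ((y')^*)'$.
   Context: A semi-Heyting algebra is an algebra $\langle L,\vee,\wedge,\to,0,1\rangle$ such that $\langle L,\vee,\wedge,0,1\rangle$ is a bounded lattice and the identities $x\wedge(x\to y)\approx x\wedge y$, $x\wedge(y\to z)\approx x\wedge[(x\wedge y)\to(x\wedge z)]$, and $x\to x\approx 1$ hold; $x^* := x\to 0$ is the pseudocomplement. A dually quasi-De Morgan semi-Heyting algebra is an algebra $\langle L,\vee,\wedge,\to,{}',0,1\rangle$ whose reduct $\langle L,\vee,\wedge,\to,0,1\rangle$ is a semi-Heyting algebra and which satisfies $0'\approx 1$, $1'\approx 0$, $(x\wedge y)'\approx x'\vee y'$, $(x\vee y)''\approx x''\vee y''$, and $x''\le x$. A dually ms Stone semi-Heyting algebra is a dually quasi-De Morgan semi-Heyting algebra that additionally satisfies $(x\vee y)'\approx x'\wedge y'$ and the Stone identity $x^*\vee x^{**}\approx 1$. -}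

module Defs where

open import Level using (Level; suc)
open import Relation.Binary.PropositionalEquality using (_≡_)
open import Algebra.Core using (Op₁; Op₂)
open import Algebra.Lattice.Structures using (IsLattice)

record DmsStoneSH (c : Level) : Set (suc c) where
  infixr 6 _∨_
  infixr 7 _∧_
  infixr 5 _⇒_
  field
    Carrier : Set c
    _∨_ _∧_ _⇒_ : Op₂ Carrier
    ′ : Op₁ Carrier
    𝟘 𝟙 : Carrier
    isLattice : IsLattice _≡_ _∨_ _∧_
    𝟘-least : ∀ x → 𝟘 ∧ x ≡ 𝟘
    𝟙-greatest : ∀ x → 𝟙 ∧ x ≡ x
    sh1 : ∀ x y → x ∧ (x ⇒ y) ≡ x ∧ y
    sh2 : ∀ x y z → x ∧ (y ⇒ z) ≡ x ∧ ((x ∧ y) ⇒ (x ∧ z))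
    sh3 : ∀ x → x ⇒ x ≡ 𝟙
    dq1 : ′ 𝟘 ≡ 𝟙
    dq2 : ′ 𝟙 ≡ 𝟘
    dq3 : ∀ x y → ′ (x ∧ y) ≡ ′ x ∨ ′ y
    dq4 : ∀ x y → ′ (′ (x ∨ y)) ≡ ′ (′ x) ∨ ′ (′ y)
    dq5 : ∀ x → ′ (′ x) ∧ x ≡ ′ (′ x)
    dms : ∀ x y → ′ (x ∨ y) ≡ ′ x ∧ ′ y
    stone : ∀ x → (x ⇒ 𝟘) ∨ ((x ⇒ 𝟘) ⇒ 𝟘) ≡ 𝟙

  _* : Op₁ Carrier
  x * = x ⇒ 𝟘

  _⁺ : Op₁ Carrier
  y ⁺ = ′ ((′ y) *)

module Submission where

-- Put a = x* and d = a* = x**.  The semi-Heyting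
-- reduct becomes a Heyting algebra once its implication is relativised,
-- x ⇝ y = x → (x ∧ y), and the pseudocomplement of that Heyting algebra is
-- exactly _*.  In particular the lattice is distributive, so a complemented
-- pair (b ∧ c = 0, b ∨ c = 1) satisfies b* = c.  By the Stone identity a and
-- d form such a pair.  The dually ms axioms show that ′ sends a complemented
-- pair to a complemented pair, and the quasi-De Morgan axioms show that
-- every complemented element is fixed by ′′.  Hence
--   (x*)⁺ = ′ ((′ a)*) = ′ (′ d) = d = x**.

open import Defs
open import Level using (Level)
open import Data.Product using (_×_; _,_)
open import Relation.Binary.PropositionalEquality
  using (_≡_; sym; trans; cong; module ≡-Reasoning)
open import Relation.Binary.Lattice using (Lattice; HeytingAlgebra)
import Algebra.Lattice.Bundles as Alg
import Algebra.Lattice.Properties.Lattice as AlgLatticeProperties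
import Relation.Binary.Lattice.Properties.MeetSemilattice
import Relation.Binary.Lattice.Properties.JoinSemilattice
import Relation.Binary.Lattice.Properties.HeytingAlgebra as HeytingAlgebraProperties
import Relation.Binary.Reasoning.PartialOrder as PartialOrderReasoning

module ComplementedPairs {c ℓ₁ ℓ₂ : Level} (H : HeytingAlgebra c ℓ₁ ℓ₂) where
  open HeytingAlgebra H renaming (refl to ≤-refl)
  open HeytingAlgebraProperties H using (∧-distribˡ-∨-≤; ¬_; ⇨-eval; swap-transpose-⇨)
  open Relation.Binary.Lattice.Properties.MeetSemilattice meetSemilattice using (∧-cong)
  open Relation.Binary.Lattice.Properties.JoinSemilattice joinSemilattice using (∨-monotonic)
  open PartialOrderReasoning poset

  disjoint-cover⇒≤ : ∀ {p q r} → p ∧ q ≈ ⊥ → q ∨ r ≈ ⊤ → p ≤ r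
  disjoint-cover⇒≤ {p} {q} {r} p∧q≈⊥ q∨r≈⊤ = begin
    p                  ≤⟨ ∧-greatest ≤-refl (maximum p) ⟩
    p ∧ ⊤              ≈⟨ ∧-cong Eq.refl (Eq.sym q∨r≈⊤) ⟩
    p ∧ (q ∨ r)        ≤⟨ ∧-distribˡ-∨-≤ p q r ⟩
    p ∧ q ∨ p ∧ r      ≤⟨ ∨-monotonic (reflexive p∧q≈⊥) (x∧y≤y p r) ⟩
    ⊥ ∨ r              ≤⟨ ∨-least (minimum r) ≤-refl ⟩
    r                  ∎

  complement⇒¬ : ∀ {b c} → b ∧ c ≈ ⊥ → b ∨ c ≈ ⊤ → ¬ b ≈ c
  complement⇒¬ {b} {c} b∧c≈⊥ b∨c≈⊤ = antisym
    (disjoint-cover⇒≤ (antisym ⇨-eval (minimum _)) b∨c≈⊤)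
    (swap-transpose-⇨ (reflexive b∧c≈⊥))

module UnderlyingHeytingAlgebra {c : Level} (L : DmsStoneSH c) where
  open DmsStoneSH L

  algLattice : Alg.Lattice c c
  algLattice = record { isLattice = isLattice }

  open Alg.Lattice algLattice using (∧-comm; ∧-assoc)
  open AlgLatticeProperties algLattice using (∨-∧-orderTheoreticLattice)

  -- The lattice order: x ≤ y iff x ≡ x ∧ y.
  open Lattice ∨-∧-orderTheoreticLattice
    using (_≤_; x∧y≤y; meetSemilattice; poset) renaming (refl to ≤-refl)
  open Relation.Binary.Lattice.Properties.MeetSemilattice meetSemilattice using (∧-monotonic)
  open PartialOrderReasoning poset

  x∧𝟘≡𝟘 : ∀ x → x ∧ 𝟘 ≡ 𝟘
  x∧𝟘≡𝟘 x = trans (∧-comm x 𝟘) (𝟘-least x)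

  -- Relativised implication; it is the Heyting implication of the lattice.
  _⇝_ : Carrier → Carrier → Carrier
  x ⇝ y = x ⇒ (x ∧ y)

  ⇝-intro : ∀ {w x y} → w ∧ x ≤ y → w ≤ x ⇝ y
  ⇝-intro {w} {x} {y} w∧x≤y = sym (begin-equality
    w ∧ (x ⇒ (x ∧ y))               ≡⟨ sh2 w x (x ∧ y) ⟩
    w ∧ ((w ∧ x) ⇒ (w ∧ (x ∧ y)))   ≡⟨ cong (λ u → w ∧ ((w ∧ x) ⇒ u)) (sym (∧-assoc w x y)) ⟩
    w ∧ ((w ∧ x) ⇒ ((w ∧ x) ∧ y))   ≡⟨ cong (λ u → w ∧ ((w ∧ x) ⇒ u)) (sym w∧x≤y) ⟩
    w ∧ ((w ∧ x) ⇒ (w ∧ x))         ≡⟨ cong (w ∧_) (sh3 (w ∧ x)) ⟩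
    w ∧ 𝟙                           ≡⟨ ∧-comm w 𝟙 ⟩
    𝟙 ∧ w                           ≡⟨ 𝟙-greatest w ⟩
    w                               ∎)

  ⇝-elim : ∀ {w x y} → w ≤ x ⇝ y → w ∧ x ≤ y
  ⇝-elim {w} {x} {y} w≤x⇝y = begin
    w ∧ x              ≤⟨ ∧-monotonic w≤x⇝y ≤-refl ⟩
    (x ⇝ y) ∧ x        ≈⟨ ∧-comm (x ⇝ y) x ⟩
    x ∧ (x ⇒ (x ∧ y))  ≈⟨ sh1 x (x ∧ y) ⟩
    x ∧ (x ∧ y)        ≤⟨ x∧y≤y x (x ∧ y) ⟩
    x ∧ y              ≤⟨ x∧y≤y x y ⟩
    y                  ∎

  heytingAlgebra : HeytingAlgebra c c c
  heytingAlgebra = record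
    { isHeytingAlgebra = record
      { isBoundedLattice = record
        { isLattice = Lattice.isLattice ∨-∧-orderTheoreticLattice
        ; maximum   = λ x → trans (sym (𝟙-greatest x)) (∧-comm 𝟙 x)
        ; minimum   = λ x → sym (𝟘-least x)
        }
      ; exponential = λ w x y → ⇝-intro , ⇝-elim
      }
    }

  open HeytingAlgebraProperties heytingAlgebra using (¬_)

  *≡¬ : ∀ x → x * ≡ ¬ x
  *≡¬ x = cong (x ⇒_) (sym (x∧𝟘≡𝟘 x))

module DuallyMsStone {c : Level} (L : DmsStoneSH c) where
  open DmsStoneSH L
  open UnderlyingHeytingAlgebra L using (algLattice; heytingAlgebra; *≡¬; x∧𝟘≡𝟘)
  open Alg.Lattice algLattice using (∧-comm)
  open HeytingAlgebra heytingAlgebra using (antisym; maximum) renaming (refl to ≤-refl)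
  open Relation.Binary.Lattice.Properties.JoinSemilattice
    (HeytingAlgebra.joinSemilattice heytingAlgebra) using (∨-monotonic)
  open ComplementedPairs heytingAlgebra using (disjoint-cover⇒≤; complement⇒¬)
  open PartialOrderReasoning (HeytingAlgebra.poset heytingAlgebra)

  IsComplement : Carrier → Carrier → Set c
  IsComplement b c = b ∧ c ≡ 𝟘 × b ∨ c ≡ 𝟙

  complement⇒* : ∀ {b c} → IsComplement b c → b * ≡ c
  complement⇒* {b} (b∧c≡𝟘 , b∨c≡𝟙) = trans (*≡¬ b) (complement⇒¬ b∧c≡𝟘 b∨c≡𝟙)

  stone-complement : ∀ x → IsComplement (x *) (x * *)
  stone-complement x = trans (sh1 (x *) 𝟘) (x∧𝟘≡𝟘 (x *)) , stone x

  -- ′ preserves complemented pairs: the dually ms law and dq3 swap ∧ and ∨.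
  ′-complement : ∀ {b c} → IsComplement b c → IsComplement (′ b) (′ c)
  ′-complement {b} {c} (b∧c≡𝟘 , b∨c≡𝟙) =
    trans (sym (dms b c)) (trans (cong ′ b∨c≡𝟙) dq2) ,
    trans (sym (dq3 b c)) (trans (cong ′ b∧c≡𝟘) dq1)

  -- A complemented element is fixed by ′′: x'' ≤ x always, and the
  -- reverse inequality follows because b ∨ c'' still covers 𝟙.
  ′′-fixes-complement : ∀ {b c} → IsComplement b c → ′ (′ c) ≡ c
  ′′-fixes-complement {b} {c} (b∧c≡𝟘 , b∨c≡𝟙) =
    antisym (sym (dq5 c)) (disjoint-cover⇒≤ (trans (∧-comm c b) b∧c≡𝟘) b∨c''≡𝟙)
    where
    b∨c''≡𝟙 : b ∨ ′ (′ c) ≡ 𝟙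
    b∨c''≡𝟙 = antisym (maximum _) (begin
      𝟙                     ≡⟨ sym dq1 ⟩
      ′ 𝟘                   ≡⟨ cong ′ (sym dq2) ⟩
      ′ (′ 𝟙)               ≡⟨ cong (λ u → ′ (′ u)) (sym b∨c≡𝟙) ⟩
      ′ (′ (b ∨ c))         ≡⟨ dq4 b c ⟩
      ′ (′ b) ∨ ′ (′ c)     ≤⟨ ∨-monotonic (sym (dq5 b)) ≤-refl ⟩
      b ∨ ′ (′ c)           ∎)

lemma4p7 : ∀ {c : Level} (L : DmsStoneSH c) (x : DmsStoneSH.Carrier L) →
    DmsStoneSH._⁺ L (DmsStoneSH._* L x) ≡ DmsStoneSH._* L (DmsStoneSH._* L x)
lemma4p7 L x = begin
  ′ ((′ (x *)) *)   ≡⟨ cong ′ (complement⇒* (′-complement (stone-complement x))) ⟩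
  ′ (′ (x * *))     ≡⟨ ′′-fixes-complement (stone-complement x) ⟩
  x * *             ∎
  where
  open DmsStoneSH L
  open DuallyMsStone L
  open ≡-Reasoning
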